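{- Let $\alpha\in\{+,-\}$ and let $G$ be a linear $\alpha$-semiradial with root $r\in V(G)$. Let $F$ be the set of $(\alpha,\alpha)$-edges of $G$. Then $G-F$ is digraphic. Additionally, in the strong component decomposition of the $\alpha$-digraphic bidirected graph $G-F$: (i) $(G-F)[r]$ is a strong component that is maximal; and (ii) each maximal strong component $C$ distinct from $(G-F)[r]$ has a vertex that is joined to $r$ by an $(\alpha,\alpha)$-edge of $G$.
   Context: A bidirected graph $G$ is a finite graph (loops and parallel edges allowed) with maps $\partial_+,\partial_-:E(G)\to 2^{V(G)}$ such that for each edge $e$ with (possibly identical) ends $u,v$: $\partial_\alpha(e)\subseteq\{u,v\}$, $\partial_+(e)\cup\partial_-(e)=\{u,v\}$, and $\partial_+(e)\cap\partial_-(e)=\emptyset$ if $e$ is not a loop. If $u\in\partial_\alpha(e)$, the sign of $u$ over $e$ is $\alpha$; $-\alpha$ denotes the opposite sign. An edge is a $(\beta,\beta)$-edge if all its ends have sign $\beta$; it is a $(+,-)$-edge if both $\partial_+(e),\partial_-(e)$ are nonempty. A bidirected graph is digraphic if every edge is a $(+,-)$-edge; it is then viewed as the $\alpha$-digraphic graph, i.e., the digraph in which each edge is an arc from its end with sign $\alpha$ to its end with sign $-\alpha$. Strong components are the maximal strongly connected subgraphs of this digraph (independent of $\alpha$); the strong component decomposition is the set of strong components partially ordered by $C\preceq D$ iff there is a directed path from a vertex of $C$ to a vertex of $D$; a strong component is maximal if it is maximal in this order. A walk is a sequence $W=(w_1,\dots,w_k)$, $k$ odd, with $w_i$ a vertex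 for odd $i$ and $w_i$ an edge joining $w_{i-1},w_{i+1}$ for even $i$; a trail has no repeated edge. $W$ is a diwalk if to each traversal of an edge $w_i$ one can assign signs to its end-occurrences equal to the signs of these vertices over $w_i$ (for a $(+,-)$-loop the two assigned signs are distinct), such that at every internal vertex term the signs assigned from the preceding and following edges are distinct. A ditrail is a diwalk that is a trail. For $k\ge3$ the sign of $w_1$ (resp. $w_k$) over $W$ is the sign assigned at $w_2$ (resp. $w_{k-1}$); $W$ is an $(\alpha,\beta)$-ditrail if these are $\alpha,\beta$, and an $\alpha$-ditrail if it is an $(\alpha,\beta)$-ditrail for some $\beta$; the trivial ditrail $(v)$ counts as both a $(+,-)$- and a $(-,+)$-ditrail. $G$ is an $\alpha$-semiradial with root $r$ if every $v$ has an $\alpha$-ditrail from $v$ to $r$; it is linear if $G$ has no loop at $r$ and no $-\alpha$-ditrail from any $x\in V(G)$ to $r$ other than the trivial ditrail $(r)$. -}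

module Defs where

open import Data.Nat using (ℕ)
open import Data.Fin using (Fin)
open import Data.Bool using (Bool; true; false)
open import Data.List using (List; []; _∷_)
open import Data.List.Relation.Unary.Unique.Propositional using (Unique)
open import Data.Product using (Σ; ∃; _×_; _,_)
open import Data.Sum using (_⊎_)
open import Relation.Binary.PropositionalEquality using (_≡_; _≢_)
open import Relation.Binary.Construct.Closure.ReflexiveTransitive using (Star)
open import Relation.Nullary using (¬_)

data Sign : Set where
  plus minus : Sign

opp : Sign → Sign
opp plus  = minus
opp minus = plus

-- Every edge e has two end-occurrences (end₁ e, sgn₁ e) and (end₂ e, sgn₂ e):
-- the vertex and its sign over e.  A non-loop edge with ends u ≠ v thus has
-- ∂_{sgn₁ e}(e) ∋ end₁ e and ∂_{sgn₂ e}(e) ∋ end₂ e; a loop is a (β,β)-loop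
-- if sgn₁ e ≡ sgn₂ e ≡ β and a (+,-)-loop if sgn₁ e ≢ sgn₂ e.
record BiGraph (n m : ℕ) : Set where
  field
    end₁ end₂ : Fin m → Fin n
    sgn₁ sgn₂ : Fin m → Sign
open BiGraph public

module _ {n m : ℕ} (G : BiGraph n m) where

  tl hd : Fin m → Bool → Fin n
  tl e true  = end₁ G e
  tl e false = end₂ G e
  hd e true  = end₂ G e
  hd e false = end₁ G e

  ts hs : Fin m → Bool → Sign
  ts e true  = sgn₁ G e
  ts e false = sgn₂ G e
  hs e true  = sgn₂ G e
  hs e false = sgn₁ G e

  -- Non-trivial diwalks: DiWalk x α y β es  is a diwalk from x to y using the
  -- edge sequence es, where x has sign α and y has sign β over the walk.
  data DiWalk : Fin n → Sign → Fin n → Sign → List (Fin m) → Set where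
    one  : ∀ e d → DiWalk (tl e d) (ts e d) (hd e d) (hs e d) (e ∷ [])
    cons : ∀ e d {s y t es} → DiWalk (hd e d) s y t es → hs e d ≢ s →
           DiWalk (tl e d) (ts e d) y t (e ∷ es)

  DiTrail : Fin n → Sign → Fin n → Sign → Set
  DiTrail x α y β =
    (x ≡ y × α ≢ β) ⊎ (∃ λ es → DiWalk x α y β es × Unique es)

  αDiTrail : Sign → Fin n → Fin n → Set
  αDiTrail α x y = ∃ λ β → DiTrail x α y β

  IsSemiradial : Sign → Fin n → Set
  IsSemiradial α r = ∀ v → αDiTrail α v r

  IsLinear : Sign → Fin n → Set
  IsLinear α r =
    (∀ e → ¬ (end₁ G e ≡ r × end₂ G e ≡ r)) ×
    (∀ x β es → ¬ (DiWalk x (opp α) r β es × Unique es))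

  IsBB : Sign → Fin m → Set
  IsBB β e = sgn₁ G e ≡ β × sgn₂ G e ≡ β

  Joins : Fin m → Fin n → Fin n → Set
  Joins e u v = (end₁ G e ≡ u × end₂ G e ≡ v) ⊎ (end₁ G e ≡ v × end₂ G e ≡ u)

  -- The subgraph G - F where F is the set of (α,α)-edges: same vertices,
  -- edges are those e with ¬ IsBB α e.
  InGF : Sign → Fin m → Set
  InGF α e = ¬ IsBB α e

  GFDigraphic : Sign → Set
  GFDigraphic α = ∀ e → InGF α e → sgn₁ G e ≢ sgn₂ G e

  Arc : Sign → Fin n → Fin n → Set
  Arc α x y = ∃ λ e → InGF α e × ∃ λ d →
    tl e d ≡ x × ts e d ≡ α × hd e d ≡ y × hs e d ≡ opp α

  Reach : Sign → Fin n → Fin n → Set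
  Reach α = Star (Arc α)

  SameSet : (Fin n → Set) → (Fin n → Set) → Set
  SameSet C D = ∀ y → (C y → D y) × (D y → C y)

  IsStrongComponent : Sign → (Fin n → Set) → Set
  IsStrongComponent α C =
    ∃ λ x → ∀ y → (C y → Reach α x y × Reach α y x) × (Reach α x y × Reach α y x → C y)

  Below : Sign → (Fin n → Set) → (Fin n → Set) → Set
  Below α C D = ∃ λ u → ∃ λ v → C u × D v × Reach α u v

  IsMaximalSC : Sign → (Fin n → Set) → Set₁
  IsMaximalSC α C = IsStrongComponent α C ×
    (∀ D → IsStrongComponent α D → Below α C D → SameSet D C)

module Submission where

-- Linearity says that every non-trivial ditrail ending at r
-- leaves its first vertex with sign α.  Three consequences follow.
--   * There is no (-α,-α)-edge e: the α-ditrail from one end of e to r either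
--     uses e, and then its part from e onwards starts with sign -α, or it does
--     not, and then prefixing e gives such a ditrail.  Hence every edge of
--     G - F is a (+,-)-edge, i.e. G - F is digraphic.
--   * No arc of the α-digraph G - F leaves r, so r is a sink and {r} is a
--     maximal strong component (a general fact about sinks of digraphs).
--   * Along a ditrail to r every edge is traversed from sign α to sign -α,
--     except possibly the last one, which may be an (α,α)-edge into r.  So
--     every vertex x either reaches r in G - F, or reaches the tail of an
--     (α,α)-edge whose head is r.
-- Since a maximal strong component is closed under reachability, a maximal
-- component C ≠ {r} cannot reach r, and so it contains the tail of such an edge.

open import Defs
open import Data.Fin using (Fin; _≟_)
open import Data.Nat using (ℕ)
open import Data.Bool using (true; false)
open import Data.List.Relation.Unary.All using ([])
open import Data.List.Relation.Unary.All.Properties using (¬Any⇒All¬)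
open import Data.List.Relation.Unary.Any using (here; there; any?)
open import Data.List.Membership.Propositional using (_∈_)
open import Data.List.Relation.Unary.AllPairs using ([]; _∷_)
open import Data.List.Relation.Unary.Unique.Propositional using (Unique)
open import Data.Product using (∃; _×_; _,_; proj₁; proj₂)
open import Data.Sum using (_⊎_; inj₁; inj₂)
open import Data.Empty using (⊥-elim)
open import Relation.Binary.PropositionalEquality using (_≡_; refl; sym; trans; subst)
open import Relation.Binary.Construct.Closure.ReflexiveTransitive using (ε; _◅_)
open import Relation.Nullary using (¬_; yes; no)

sign-cases : ∀ s α → s ≡ α ⊎ s ≡ opp α
sign-cases plus  plus  = inj₁ refl
sign-cases plus  minus = inj₂ refl
sign-cases minus plus  = inj₂ refl
sign-cases minus minus = inj₁ refl

clash : ∀ {s α} → s ≡ opp α → ¬ s ≡ α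
clash {α = plus}  refl ()
clash {α = minus} refl ()

module Traversals {n m : ℕ} (G : BiGraph n m) where

  bb-start : ∀ {β} e d → IsBB G β e → ts G e d ≡ β
  bb-start e true  (s₁ , _) = s₁
  bb-start e false (_ , s₂) = s₂

  bb-end : ∀ {β} e d → IsBB G β e → hs G e d ≡ β
  bb-end e true  (_ , s₂) = s₂
  bb-end e false (s₁ , _) = s₁

  bb-of-traversal : ∀ {β} e d → ts G e d ≡ β → hs G e d ≡ β → IsBB G β e
  bb-of-traversal e true  p q = p , q
  bb-of-traversal e false p q = q , p

  traversal-joins : ∀ {y} e d → hd G e d ≡ y → Joins G e (tl G e d) y
  traversal-joins e true  h = inj₁ (refl , h)
  traversal-joins e false h = inj₂ (h , refl)

  suffix-from : ∀ {x s y t es} (e : Fin m) → DiWalk G x s y t es → Unique es → e ∈ es →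
    ∃ λ d → ∃ λ es' → DiWalk G (tl G e d) (ts G e d) y t es' × Unique es'
  suffix-from e (one .e d)         u       (here refl) = d , _ , one e d , u
  suffix-from e (cons .e d w hs≢s) u       (here refl) = d , _ , cons e d w hs≢s , u
  suffix-from e (cons _ d w _)     (_ ∷ u) (there e∈) = suffix-from e w u e∈

module StrongComponents {n m : ℕ} (G : BiGraph n m) (α : Sign) where

  componentOf : Fin n → Fin n → Set
  componentOf v y = Reach G α v y × Reach G α y v

  componentOf-isSC : ∀ v → IsStrongComponent G α (componentOf v)
  componentOf-isSC v = v , λ y → (λ both → both) , (λ both → both)

  representative : ∀ {C} → IsStrongComponent G α C → ∃ C
  representative (x , f) = x , proj₂ (f x) (ε , ε)

  -- A maximal strong component is closed under reachability: the component
  -- of a reachable vertex lies above it, hence coincides with it.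
  maximal-closed : ∀ {C x v} → IsMaximalSC G α C → C x → Reach G α x v → C v
  maximal-closed {v = v} (_ , maximal) Cx x↝v =
    proj₁ (maximal (componentOf v) (componentOf-isSC v) (_ , v , Cx , (ε , ε) , x↝v) v) (ε , ε)

  sink-reach : ∀ {r} → (∀ {y} → ¬ Arc G α r y) → ∀ {y} → Reach G α r y → y ≡ r
  sink-reach no-arc ε       = refl
  sink-reach no-arc (a ◅ _) = ⊥-elim (no-arc a)

  module Sink (r : Fin n) (sink : ∀ {y} → Reach G α r y → y ≡ r) where

    component-of-sink : ∀ {C} → IsStrongComponent G α C → C r → SameSet G C (_≡ r)
    component-of-sink {C} (x , f) Cr y =
      (λ Cy → sink (subst (λ z → Reach G α z y) x≡r (proj₁ (proj₁ (f y) Cy)))) ,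
      (λ { refl → Cr })
      where
        x≡r : x ≡ r
        x≡r = sink (proj₂ (proj₁ (f r) Cr))

    singleton-maximal : IsMaximalSC G α (_≡ r)
    singleton-maximal =
      (r , λ y → (λ { refl → ε , ε }) , (λ both → sink (proj₁ both))) ,
      λ { D D-sc (u , v , refl , Dv , r↝v) → component-of-sink D-sc (subst D (sink r↝v) Dv) }

module Linear {n m : ℕ} (G : BiGraph n m) (α : Sign) (r : Fin n)
  (linear : ∀ x β es → ¬ (DiWalk G x (opp α) r β es × Unique es)) where
  open Traversals G
  open StrongComponents G α

  starts-with-α : ∀ {x s y t es} → y ≡ r → DiWalk G x s y t es → Unique es → s ≡ α
  starts-with-α {x} {s} {t = t} {es} refl w u with sign-cases s α
  ... | inj₁ s≡α  = s≡α
  ... | inj₂ s≡-α = ⊥-elim (linear x t es (subst (λ s' → DiWalk G x s' r t es) s≡-α w , u))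

  -- An arc out of r, traversed backwards, would be a ditrail to r starting with -α.
  no-arc-from-root : ∀ {y} → ¬ Arc G α r y
  no-arc-from-root (e , _ , true , tl≡r , _ , _ , hs≡-α) =
    clash hs≡-α (starts-with-α tl≡r (one e false) ([] ∷ []))
  no-arc-from-root (e , _ , false , tl≡r , _ , _ , hs≡-α) =
    clash hs≡-α (starts-with-α tl≡r (one e true) ([] ∷ []))

  root-is-sink : ∀ {y} → Reach G α r y → y ≡ r
  root-is-sink = sink-reach no-arc-from-root

  traversal-arc : ∀ e d → ts G e d ≡ α → hs G e d ≡ opp α → Arc G α (tl G e d) (hd G e d)
  traversal-arc e d ts≡α hs≡-α =
    e , (λ bb → clash hs≡-α (bb-end e d bb)) , d , refl , ts≡α , refl , hs≡-α

  ArrivesAt : Fin n → Fin n → Set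
  ArrivesAt x y = Reach G α x y ⊎
    ∃ λ e → ∃ λ d → Reach G α x (tl G e d) × hd G e d ≡ y × IsBB G α e

  arrives-after-arc : ∀ {x z y} → Arc G α x z → ArrivesAt z y → ArrivesAt x y
  arrives-after-arc a (inj₁ path)                     = inj₁ (a ◅ path)
  arrives-after-arc a (inj₂ (e , d , path , hd≡y , bb)) = inj₂ (e , d , a ◅ path , hd≡y , bb)

  -- Along a ditrail to r every traversal starts with α (it begins a ditrail
  -- to r); all but the last end with -α (the next one starts with α), so they
  -- are arcs; the last one is an arc or an (α,α)-edge into r.
  ditrail-to-root : ∀ {x s y t es} → y ≡ r → DiWalk G x s y t es → Unique es → ArrivesAt x y
  ditrail-to-root y≡r w@(one e d) u with sign-cases (hs G e d) α
  ... | inj₁ hs≡α  = inj₂ (e , d , ε , refl , bb-of-traversal e d (starts-with-α y≡r w u) hs≡α)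
  ... | inj₂ hs≡-α = inj₁ (traversal-arc e d (starts-with-α y≡r w u) hs≡-α ◅ ε)
  ditrail-to-root y≡r w@(cons e d rest hs≢s) u@(_ ∷ u-rest) with sign-cases (hs G e d) α
  ... | inj₁ hs≡α  = ⊥-elim (hs≢s (trans hs≡α (sym (starts-with-α y≡r rest u-rest))))
  ... | inj₂ hs≡-α = arrives-after-arc (traversal-arc e d (starts-with-α y≡r w u) hs≡-α)
                                       (ditrail-to-root y≡r rest u-rest)

  module Semiradial (semiradial : IsSemiradial G α r) where
    open Sink r root-is-sink

    -- There is no (-α,-α)-edge e: the α-ditrail from end₂ e to r, or its part
    -- after e if it uses e, extended by e, would start with sign -α.
    no-opp-edge : ∀ e → ¬ IsBB G (opp α) e
    no-opp-edge e (s₁ , s₂) with semiradial (end₂ G e)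
    ... | _ , inj₁ (end₂≡r , _) = clash s₁ (starts-with-α end₂≡r (one e true) ([] ∷ []))
    ... | _ , inj₂ (es , w , u) with any? (e ≟_) es
    ...   | yes e∈es with suffix-from e w u e∈es
    ...     | d , _ , w' , u' = clash (bb-start e d (s₁ , s₂)) (starts-with-α refl w' u')
    no-opp-edge e (s₁ , s₂) | _ , inj₂ (es , w , u) | no e∉es =
      clash s₁ (starts-with-α refl (cons e true w (clash s₂)) (¬Any⇒All¬ es e∉es ∷ u))

    digraphic : GFDigraphic G α
    digraphic e not-bb s₁≡s₂ with sign-cases (sgn₁ G e) α
    ... | inj₁ s₁≡α  = not-bb (s₁≡α , trans (sym s₁≡s₂) s₁≡α)
    ... | inj₂ s₁≡-α = no-opp-edge e (s₁≡-α , trans (sym s₁≡s₂) s₁≡-α)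

    -- Part (ii): a maximal component C ≠ {r} does not contain r, so the
    -- ditrail from its representative to r leaves C through an (α,α)-edge.
    maximal-touches-root : ∀ (C : Fin n → Set) → IsMaximalSC G α C → ¬ SameSet G C (_≡ r) →
      ∃ λ v → C v × ∃ λ e → IsBB G α e × Joins G e v r
    maximal-touches-root C maxC C≠r with representative (proj₁ maxC)
    ... | x , Cx with semiradial x
    ...   | _ , inj₁ (x≡r , _) = ⊥-elim (C≠r (component-of-sink (proj₁ maxC) (subst C x≡r Cx)))
    ...   | _ , inj₂ (_ , w , u) with ditrail-to-root refl w u
    ...     | inj₁ x↝r = ⊥-elim (C≠r (component-of-sink (proj₁ maxC) (maximal-closed maxC Cx x↝r)))
    ...     | inj₂ (e , d , x↝v , hd≡r , bb) =
              tl G e d , maximal-closed maxC Cx x↝v , e , bb , traversal-joins e d hd≡r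

lemma11p5 : ∀ {n m} (G : BiGraph n m) (α : Sign) (r : Fin n) →
    IsSemiradial G α r → IsLinear G α r →
    GFDigraphic G α ×
    IsMaximalSC G α (λ v → v ≡ r) ×
    (∀ (C : Fin n → Set) → IsMaximalSC G α C → ¬ SameSet G C (λ v → v ≡ r) →
    ∃ λ v → C v × ∃ λ e → IsBB G α e × Joins G e v r)
lemma11p5 G α r semiradial (_ , linear) =
  digraphic , singleton-maximal , maximal-touches-root
  where
    open Linear G α r linear
    open Semiradial semiradial
    open StrongComponents.Sink G α r root-is-sink
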